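{- Let $\underline{A}=\langle A,+,-,;,{}^\smile,1'\rangle$ be an algebra satisfying $1'^\smile=1'$ and $x;1'=1';x=x$ for all $x$. Let $U$ be a set and let $g:A\to\mathrm{Re}(U)$ be a near-homomorphism. Then $E:=g(1')$ is an equivalence relation on $U$, and the map $h:\underline{A}\to\underline{\mathrm{Re}}(U/E)$ given by $h(a)=\{\langle r/E,s/E\rangle : \langle r,s\rangle\in g(a)\}$ is a homomorphism. Moreover, if $g$ is injective then so is $h$.
   Context: $\mathrm{Re}(U)$ is the power set of $U\times U$, and $\underline{\mathrm{Re}}(U)=\langle\mathrm{Re}(U),\cup,(U\times U)\setminus(\cdot),|,{}^{ -1},\mathrm{Id}\cap(U\times U)\rangle$ where $R|S=\{\langle x,z\rangle:\exists y\,(\langle x,y\rangle\in R\wedge\langle y,z\rangle\in S)\}$, $R^{ -1}=\{\langle x,y\rangle:\langle y,x\rangle\in R\}$ and $\mathrm{Id}$ is the identity relation. $U/E$ denotes the set of $E$-classes $r/E$. A near-homomorphism $g:A\to\mathrm{Re}(U)$ is a map such that for all $a,b\in A$: $g(a+b)=g(a)\cup g(b)$ (so $g$ is monotone for $a\le b\iff a+b=b$), $g(-a)=(U\times U)\setminus g(a)$ (so $g(a\cdot -a)=\emptyset$ and $g(a+-a)=U\times U$), $g(a;b)=g(a)|g(b)$, $g(a^\smile)=g(a)^{ -1}$, and $g(1')\supseteq\mathrm{Id}\cap(U\times U)$; i.e. it satisfies all homomorphism conditions except that $g(1')$ need only contain the identity on $U$. -}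

module Defs where

open import Data.Product using (Σ; ∃; _×_; _,_)
open import Data.Sum using (_⊎_)
open import Relation.Nullary using (¬_)
open import Relation.Binary.PropositionalEquality using (_≡_)

-- An algebra ⟨A, +, -, ;, ˘, 1'⟩ (signature of relation algebras; no axioms).
-- ';' is reserved in Agda, so composition is written _⨾_ ; the constant 1' is ι.
record RAlg : Set₁ where
  field
    Carrier : Set
    _+_     : Carrier → Carrier → Carrier
    -_      : Carrier → Carrier
    _⨾_     : Carrier → Carrier → Carrier
    _˘      : Carrier → Carrier
    ι       : Carrier

Re : Set → Set₁
Re U = U → U → Set

module _ {U : Set} where
  _∪ʳ_ : Re U → Re U → Re U
  (R ∪ʳ S) x y = R x y ⊎ S x y

  ∁ʳ : Re U → Re U
  ∁ʳ R x y = ¬ R x y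

  _∣ʳ_ : Re U → Re U → Re U
  (R ∣ʳ S) x z = ∃ λ y → R x y × S y z

  _⁻¹ʳ : Re U → Re U
  (R ⁻¹ʳ) x y = R y x

  Idʳ : Re U
  Idʳ x y = x ≡ y

  _⊆ʳ_ : Re U → Re U → Set
  R ⊆ʳ S = ∀ x y → R x y → S x y

  _≐_ : Re U → Re U → Set
  R ≐ S = (R ⊆ʳ S) × (S ⊆ʳ R)

record IsNearHom (A : RAlg) {U : Set} (g : RAlg.Carrier A → Re U) : Set₁ where
  open RAlg A
  field
    pres-+ : ∀ a b → g (a + b) ≐ (g a ∪ʳ g b)
    pres-- : ∀ a → g (- a) ≐ ∁ʳ (g a)
    pres-⨾ : ∀ a b → g (a ⨾ b) ≐ (g a ∣ʳ g b)
    pres-˘ : ∀ a → g (a ˘) ≐ (g a ⁻¹ʳ)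
    pres-ι : Idʳ ⊆ʳ g ι

record IsHom (A : RAlg) {V : Set} (h : RAlg.Carrier A → Re V) : Set₁ where
  open RAlg A
  field
    pres-+ : ∀ a b → h (a + b) ≐ (h a ∪ʳ h b)
    pres-- : ∀ a → h (- a) ≐ ∁ʳ (h a)
    pres-⨾ : ∀ a b → h (a ⨾ b) ≐ (h a ∣ʳ h b)
    pres-˘ : ∀ a → h (a ˘) ≐ (h a ⁻¹ʳ)
    pres-ι : h ι ≐ Idʳ

InjectiveRe : (A : RAlg) {V : Set} → (RAlg.Carrier A → Re V) → Set
InjectiveRe A h = ∀ a b → h a ≐ h b → a ≡ b

-- π : U → Q is a quotient map for E : Q is (a copy of) U/E with π r = r/E
IsQuotientMap : {U Q : Set} → Re U → (U → Q) → Set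
IsQuotientMap {U} {Q} E π =
  (∀ q → ∃ λ r → π r ≡ q) × (∀ r s → (π r ≡ π s → E r s) × (E r s → π r ≡ π s))

induced : {A : RAlg} {U Q : Set} → (U → Q) → (RAlg.Carrier A → Re U) → RAlg.Carrier A → Re Q
induced π g a x y = ∃ λ r → ∃ λ s → π r ≡ x × π s ≡ y × g a r s

module Submission where

-- Write E = g(1').  Since g(1') contains the identity, g(1'˘) = g(1')⁻¹
-- and g(1' ; 1') = g(1') | g(1'), the unit laws make E reflexive, symmetric and
-- transitive.  The unit laws also give g(a) = g(1' ; a ; 1') = E | g(a) | E, i.e.
-- every g(a) is E-saturated.  The map h is the image of g under the quotient map
-- π : U → U/E, and for E-saturated relations taking images behaves perfectly:
-- ⟨π r, π s⟩ ∈ image R  iff  ⟨r, s⟩ ∈ R.  From this one reads off that the image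
-- commutes with union, complement, composition and converse, sends E to the
-- identity, and reflects equality of relations.

open import Defs
open import Data.Product using (_×_; _,_; ∃; proj₁; proj₂)
open import Data.Sum using (inj₁; inj₂)
open import Relation.Binary.PropositionalEquality using (_≡_; refl; sym; trans; subst)
open import Relation.Binary.Definitions using (Reflexive; Symmetric; Transitive)
open import Relation.Binary.Structures using (IsEquivalence)

-- R is E-saturated when E | R | E ⊆ R: membership only depends on E-classes.
Saturated : {U : Set} → Re U → Re U → Set
Saturated E R = ∀ {r r′ s′ s} → E r r′ → R r′ s′ → E s′ s → R r s

module Image {U Q : Set} (π : U → Q) where

  -- image R = { ⟨π r, π s⟩ : ⟨r, s⟩ ∈ R }; note  induced π g a = image (g a).
  image : Re U → Re Q
  image R x y = ∃ λ r → ∃ λ s → π r ≡ x × π s ≡ y × R r s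

  image-∪ : (R S : Re U) → image (R ∪ʳ S) ≐ (image R ∪ʳ image S)
  image-∪ R S = split , join
    where
    split : image (R ∪ʳ S) ⊆ʳ (image R ∪ʳ image S)
    split x y (r , s , pr , ps , inj₁ p) = inj₁ (r , s , pr , ps , p)
    split x y (r , s , pr , ps , inj₂ p) = inj₂ (r , s , pr , ps , p)
    join : (image R ∪ʳ image S) ⊆ʳ image (R ∪ʳ S)
    join x y (inj₁ (r , s , pr , ps , p)) = r , s , pr , ps , inj₁ p
    join x y (inj₂ (r , s , pr , ps , p)) = r , s , pr , ps , inj₂ p

  image-⁻¹ : (R : Re U) → image (R ⁻¹ʳ) ≐ (image R ⁻¹ʳ)
  image-⁻¹ R = (λ { x y (r , s , pr , ps , p) → s , r , ps , pr , p })
             , (λ { x y (s , r , ps , pr , p) → r , s , pr , ps , p })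

  image-∣-⊆ : (R S : Re U) → image (R ∣ʳ S) ⊆ʳ (image R ∣ʳ image S)
  image-∣-⊆ R S x y (r , s , pr , ps , (t , p , q)) =
    π t , (r , t , pr , refl , p) , (t , s , refl , ps , q)

  image-mono : {R S : Re U} → R ⊆ʳ S → image R ⊆ʳ image S
  image-mono R⊆S x y (r , s , pr , ps , p) = r , s , pr , ps , R⊆S r s p

module Quotient {U Q : Set} (E : Re U) (π : U → Q) (quotient : IsQuotientMap E π) where
  open Image π

  surjective : ∀ q → ∃ λ r → π r ≡ q
  surjective = proj₁ quotient

  related : ∀ {r s} → π r ≡ π s → E r s
  related {r} {s} = proj₁ (proj₂ quotient r s)

  identified : ∀ {r s} → E r s → π r ≡ π s
  identified {r} {s} = proj₂ (proj₂ quotient r s)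

  image-reflects : {R : Re U} → Saturated E R →
    ∀ {r s x y} → π r ≡ x → π s ≡ y → image R x y → R r s
  image-reflects sat pr ps (r′ , s′ , pr′ , ps′ , p) =
    sat (related (trans pr (sym pr′))) p (related (trans ps′ (sym ps)))

  -- Complement: saturation gives ⊆, surjectivity of π gives ⊇.
  image-∁ : {R : Re U} → Saturated E R → image (∁ʳ R) ≐ ∁ʳ (image R)
  image-∁ {R} sat = outside , inside
    where
    outside : image (∁ʳ R) ⊆ʳ ∁ʳ (image R)
    outside x y (r , s , pr , ps , ¬p) q = ¬p (image-reflects sat pr ps q)
    inside : ∁ʳ (image R) ⊆ʳ image (∁ʳ R)
    inside x y ¬q with surjective x | surjective y
    ... | r , pr | s , ps = r , s , pr , ps , λ p → ¬q (r , s , pr , ps , p)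

  -- Composition: saturation of S lets the two middle witnesses be merged.
  image-∣ : (R : Re U) {S : Re U} → Saturated E S → image (R ∣ʳ S) ≐ (image R ∣ʳ image S)
  image-∣ R {S} sat = image-∣-⊆ R S , glue
    where
    -- t₁ and t₂ lie in the same class z, so the S-step may start from t₁
    glue : (image R ∣ʳ image S) ⊆ʳ image (R ∣ʳ S)
    glue x y (z , (r , t₁ , pr , pt₁ , p) , (t₂ , s , pt₂ , ps , q)) =
      r , s , pr , ps , t₁ , p , sat (related (trans pt₁ (sym pt₂))) q (related refl)

  image-E : image E ≐ Idʳ
  image-E = (λ { x y (r , s , pr , ps , e) → trans (sym pr) (trans (identified e) ps) })
          , (λ { x .x refl → represent (surjective x) })
    where
    represent : ∀ {x} → (∃ λ r → π r ≡ x) → image E x x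
    represent (r , pr) = r , r , pr , pr , related refl

  image-injective : {R S : Re U} → Saturated E R → Saturated E S →
    image R ≐ image S → R ≐ S
  image-injective satR satS (R⊆S , S⊆R) =
    (λ r s p → image-reflects satS refl refl (R⊆S (π r) (π s) (r , s , refl , refl , p)))
    , (λ r s p → image-reflects satR refl refl (S⊆R (π r) (π s) (r , s , refl , refl , p)))

module NearHom (A : RAlg) {U : Set} {g : RAlg.Carrier A → Re U} (near : IsNearHom A g) where
  open RAlg A
  open IsNearHom near

  E : Re U
  E = g ι

  E-reflexive : Reflexive E
  E-reflexive {x} = pres-ι x x refl

  E-symmetric : ι ˘ ≡ ι → Symmetric E
  E-symmetric ι˘≡ι {x} {y} e = subst (λ c → g c y x) ι˘≡ι (proj₂ (pres-˘ ι) y x e)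

  closed-right : ∀ {a} → a ⨾ ι ≡ a → ∀ {r s′ s} → g a r s′ → E s′ s → g a r s
  closed-right {a} a⨾ι≡a {r} {s′} {s} p e =
    subst (λ c → g c r s) a⨾ι≡a (proj₂ (pres-⨾ a ι) r s (s′ , p , e))

  closed-left : ∀ {a} → ι ⨾ a ≡ a → ∀ {r r′ s} → E r r′ → g a r′ s → g a r s
  closed-left {a} ι⨾a≡a {r} {r′} {s} e p =
    subst (λ c → g c r s) ι⨾a≡a (proj₂ (pres-⨾ ι a) r s (r′ , e , p))

  E-transitive : ι ⨾ ι ≡ ι → Transitive E
  E-transitive ι⨾ι≡ι = closed-right ι⨾ι≡ι

  E-equivalence : ι ˘ ≡ ι → ι ⨾ ι ≡ ι → IsEquivalence E
  E-equivalence ι˘≡ι ι⨾ι≡ι = record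
    { refl = E-reflexive ; sym = E-symmetric ι˘≡ι ; trans = E-transitive ι⨾ι≡ι }

  saturated : (∀ x → x ⨾ ι ≡ x) → (∀ x → ι ⨾ x ≡ x) → ∀ a → Saturated E (g a)
  saturated unitʳ unitˡ a e p f = closed-left (unitˡ a) e (closed-right (unitʳ a) p f)

lemma3p2p8 : (A : RAlg) → let open RAlg A in
    (ι ˘ ≡ ι) → (∀ x → x ⨾ ι ≡ x) → (∀ x → ι ⨾ x ≡ x) →
    (U : Set) (g : Carrier → Re U) → IsNearHom A g →
    IsEquivalence (g ι)
    × ((Q : Set) (π : U → Q) → IsQuotientMap (g ι) π →
    IsHom A (induced {A} π g)
    × (InjectiveRe A g → InjectiveRe A (induced {A} π g)))
lemma3p2p8 A ι˘≡ι unitʳ unitˡ U g near =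
  E-equivalence ι˘≡ι (unitʳ ι) , λ Q π quotient → homomorphism π quotient , injective π quotient
  where
  open RAlg A
  open IsNearHom near
  open NearHom A near
  sat = saturated unitʳ unitˡ

  homomorphism : {Q : Set} (π : U → Q) → IsQuotientMap E π → IsHom A (induced {A} π g)
  homomorphism π quotient = record
    { pres-+ = λ a b → transport (pres-+ a b) (image-∪ (g a) (g b))
    ; pres-- = λ a → transport (pres-- a) (image-∁ (sat a))
    ; pres-⨾ = λ a b → transport (pres-⨾ a b) (image-∣ (g a) (sat b))
    ; pres-˘ = λ a → transport (pres-˘ a) (image-⁻¹ (g a))
    ; pres-ι = image-E
    }
    where
    open Image π
    open Quotient E π quotient
    transport : ∀ {R T} {c} → g c ≐ R → image R ≐ T → image (g c) ≐ T
    transport (g⊆R , R⊆g) (I⊆T , T⊆I) =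
      (λ x y p → I⊆T x y (image-mono g⊆R x y p)) , (λ x y p → image-mono R⊆g x y (T⊆I x y p))

  injective : {Q : Set} (π : U → Q) → IsQuotientMap E π →
    InjectiveRe A g → InjectiveRe A (induced {A} π g)
  injective π quotient g-injective a b ha≐hb =
    g-injective a b (Quotient.image-injective E π quotient (sat a) (sat b) ha≐hb)
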